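{- Let $n>m\geq 1$, and let $A,B$ be two distinct vertices of $G_{p^s}(n,m)$ with $d(A,B)=k$. Then there are vertices $A_1,\ldots, A_{2k-1}$ of $G_{p^s}(n,m)$ such that $A\stackrel{mc}{\sim}A_1 \stackrel{mc}{\sim} \cdots \stackrel{mc}{\sim} A_{2k-1} \stackrel{mc}{\sim} B$.
   Context: $p$ is a prime, $s\ge1$, $R=\mathbb{Z}_{p^s}$; vectors are row vectors. A set of $k$ vectors is unimodular if the matrix with those rows has a right inverse. For a submodule $V$, $\dim(V)$ is the largest size of a unimodular subset. A $k$-subspace is a submodule with a unimodular basis of $k$ vectors, identified with a matrix whose rows form such a basis; $\begin{pmatrix}X\\ Y\end{pmatrix}$ stacks representations. $G_{p^s}(n,m)$ has vertex set the $m$-subspaces of $R^n$, with $X\sim Y$ iff $X\cap Y$ is a linear subset of dimension $m-1$; $d$ is graph distance. Inner rank $\rho(M)$: least $r$ with $M=CD$, $C$ having $r$ columns. McCoy rank: with $I_k(M)$ the ideal generated by $k\times k$ minors ($I_0=R$), $\mathrm{rk}(M)=\max\{k:\mathrm{Ann}_R(I_k(M))=(0)\}$. Vertices $X,Y$ are Mc-adjacent, $X\stackrel{mc}{\sim}Y$, if $\rho\begin{pmatrix}X\\ Y\end{pmatrix}=\mathrm{rk}\begin{pmatrix}X\\ Y\end{pmatrix}=m+1$. -}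

module Defs where

open import Data.Nat as ℕ using (ℕ; zero; suc; _<_; _∸_)
open import Data.Nat.Divisibility using (_∣_)
open import Data.Integer as ℤ using (ℤ; +_; -_; ∣_∣; _-_)
open import Data.Fin using (Fin; zero; suc; punchIn; splitAt; toℕ; inject₁; fromℕ)
open import Data.Sum using ([_,_]′)
open import Data.Product using (Σ; ∃; _×_)
open import Relation.Nullary using (¬_)
open import Relation.Binary.PropositionalEquality using (_≡_)
open import Function.Definitions using (Injective)

-- The ring R = ℤ / qℤ is modelled by ℤ with congruence modulo q (q = p ^ s).
_≈[_]_ : ℤ → ℕ → ℤ → Set
infix 4 _≈[_]_
x ≈[ q ] y = q ∣ ∣ x - y ∣

Vect : ℕ → Set
Vect n = Fin n → ℤ

Mat : ℕ → ℕ → Set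
Mat a b = Fin a → Fin b → ℤ

sumF : ∀ {n} → (Fin n → ℤ) → ℤ
sumF {zero} f = + 0
sumF {suc n} f = f zero ℤ.+ sumF (λ i → f (suc i))

_⊗_ : ∀ {a r b} → Mat a r → Mat r b → Mat a b
(C ⊗ D) i j = sumF (λ l → C i l ℤ.* D l j)

idMat : ∀ {k} → Mat k k
idMat {suc k} zero zero = + 1
idMat {suc k} zero (suc j) = + 0
idMat {suc k} (suc i) zero = + 0
idMat {suc k} (suc i) (suc j) = idMat i j

MatEq : ℕ → ∀ {a b} → Mat a b → Mat a b → Set
MatEq q M N = ∀ i j → M i j ≈[ q ] N i j

-- A family of k vectors (the rows of M) is unimodular iff M has a right inverse over R.
Unimodular : ℕ → ∀ {k n} → Mat k n → Set
Unimodular q {k} {n} M = Σ (Mat n k) λ N → MatEq q (M ⊗ N) idMat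

Subset : ℕ → Set₁
Subset n = Vect n → Set

RowSpace : ℕ → ∀ {m n} → Mat m n → Subset n
RowSpace q {m} M v = Σ (Vect m) λ c → ∀ j → v j ≈[ q ] sumF (λ i → c i ℤ.* M i j)

_∩_ : ∀ {n} → Subset n → Subset n → Subset n
(U ∩ V) v = U v × V v

HasUnimodular : ℕ → ∀ {n} → Subset n → ℕ → Set
HasUnimodular q {n} V j = Σ (Mat j n) λ U → Unimodular q U × (∀ i → V (U i))

DimEq : ℕ → ∀ {n} → Subset n → ℕ → Set
DimEq q V d = HasUnimodular q V d × (∀ j → d < j → ¬ HasUnimodular q V j)

-- Vertices of G_{p^s}(n,m): m-subspaces, represented by unimodular m×n matrices;
-- two representations give the same vertex iff they have the same row space.
SameVertex : ℕ → ∀ {m n} → Mat m n → Mat m n → Set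
SameVertex q X Y = ∀ v → (RowSpace q X v → RowSpace q Y v) × (RowSpace q Y v → RowSpace q X v)

Adj : ℕ → ∀ {m n} → Mat m n → Mat m n → Set
Adj q {m} X Y = DimEq q (RowSpace q X ∩ RowSpace q Y) (m ∸ 1)

Walk : ℕ → ∀ {m n} → Mat m n → Mat m n → ℕ → Set
Walk q {m} {n} A B k =
  Σ (Fin (suc k) → Mat m n) λ X →
    (∀ i → Unimodular q (X i)) × MatEq q (X zero) A × MatEq q (X (fromℕ k)) B
    × (∀ (i : Fin k) → Adj q (X (inject₁ i)) (X (suc i)))

Dist : ℕ → ∀ {m n} → Mat m n → Mat m n → ℕ → Set
Dist q A B k = Walk q A B k × (∀ j → j < k → ¬ Walk q A B j)

stack : ∀ {a b c} → Mat a c → Mat b c → Mat (a ℕ.+ b) c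
stack {a} X Y i = [ X , Y ]′ (splitAt a i)

Factors : ℕ → ∀ {a b} → Mat a b → ℕ → Set
Factors q {a} {b} M r = Σ (Mat a r) λ C → Σ (Mat r b) λ D → MatEq q M (C ⊗ D)

InnerRank : ℕ → ∀ {a b} → Mat a b → ℕ → Set
InnerRank q M r = Factors q M r × (∀ r' → r' < r → ¬ Factors q M r')

sign : ∀ {k} → Fin k → ℤ
sign zero = + 1
sign (suc i) = - sign i

det : ∀ {k} → Mat k k → ℤ
det {zero} M = + 1
det {suc k} M = sumF (λ j → sign j ℤ.* (M zero j ℤ.* det (λ a b → M (suc a) (punchIn j b))))

AnnMinorsZero : ℕ → ∀ {a b} → Mat a b → ℕ → Set
AnnMinorsZero q {a} {b} M k =
  ∀ (x : ℤ) →
    (∀ (f : Fin k → Fin a) (g : Fin k → Fin b) → Injective _≡_ _≡_ f → Injective _≡_ _≡_ g →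
       (x ℤ.* det (λ i j → M (f i) (g j))) ≈[ q ] (+ 0)) →
    x ≈[ q ] (+ 0)

McCoyRank : ℕ → ∀ {a b} → Mat a b → ℕ → Set
McCoyRank q M r = AnnMinorsZero q M r × (∀ k → r < k → ¬ AnnMinorsZero q M k)

McAdj : ℕ → ∀ {m n} → Mat m n → Mat m n → Set
McAdj q {m} X Y = InnerRank q (stack X Y) (suc m) × McCoyRank q (stack X Y) (suc m)

McWalk : ℕ → ∀ {m n} → Mat m n → Mat m n → ℕ → Set
McWalk q {m} {n} A B k =
  Σ (Fin (suc k) → Mat m n) λ X →
    (∀ i → Unimodular q (X i)) × MatEq q (X zero) A × MatEq q (X (fromℕ k)) B
    × (∀ (i : Fin k) → McAdj q (X (inject₁ i)) (X (suc i)))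

-- Let X ~ Y be adjacent, so that X ∩ Y contains a unimodular family U of m - 1 vectors.  Choose w
-- such that both w ∷ X and w ∷ Y have an (m + 1)-minor that is a unit modulo p: X and Y have unit
-- m-minors, a unit vector outside the columns of such a minor extends it, and if neither of the two
-- vectors so obtained serves both matrices, their sum does.  Then Z = w ∷ U is again an m-subspace:
-- w is not a combination of the rows of U modulo p, so its residual off U has a unit coordinate,
-- from which a right inverse is built.  The rows of X stacked over Z lie in the row space of w ∷ X
-- and include its rows, so the stack factors through m + 1 columns while one of its (m + 1)-minors
-- is a unit; this pins both its inner rank and its McCoy rank to m + 1.  Hence X ~mc Z ~mc Y, and
-- subdividing every edge of a walk of length k yields the Mc-walk of length 2k.  That minors of a
-- product through fewer columns vanish follows from the Cauchy-Binet expansion of a multilinear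
-- alternating function of the columns.

module Submission where

open import Defs
open import Data.Nat as ℕ using (ℕ; zero; suc; _<_; _≤_; _^_)
import Data.Nat.Divisibility as ℕ
open import Data.Nat.Coprimality using (Coprime; coprime-divisor; coprime-Bézout)
open import Data.Nat.GCD using (module Bézout)
open import Data.Nat.Primality using (Prime; prime⇒irreducible; prime⇒nonTrivial)
import Data.Nat.Properties as ℕ
open import Data.Integer as ℤ using (ℤ; +_; -_; _-_; _+_; _*_)
import Data.Integer.Properties as ℤ
open import Data.Integer.Divisibility.Signed as ∣ using (_∣_; _∣?_)
open import Data.Integer.Tactic.RingSolver using (solve-∀)
open import Data.Fin as Fin using (Fin; zero; suc)
import Data.Fin.Properties as Fin
open import Data.Vec.Functional using (Vector; _∷_; tail; map; removeAt; updateAt; transpose)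
open import Data.Vec.Functional.Properties using (updateAt-updates; updateAt-minimal; updateAt-commutes; updateAt-id-local)
open import Data.Product using (Σ; ∃; _×_; _,_; proj₁; proj₂)
open import Relation.Nullary using (¬_; yes; no; contradiction; ¬?)
open import Data.Sum using (_⊎_; inj₁; inj₂; [_,_]′)
open import Relation.Binary.PropositionalEquality
open import Function using (_∘_; const)
open import Function.Definitions using (Injective)
open import Relation.Binary.Definitions using (tri<; tri≈; tri>)
open import Relation.Binary.Bundles using (Setoid)
import Relation.Binary.Reasoning.Setoid
open import Algebra.Definitions.RawMonoid ℤ.*-1-rawMonoid using () renaming (sum to product)
open import Algebra.Properties.Semiring.Sum ℤ.+-*-semiring
  using (sum; sum-cong-≗; ∑-distrib-+; *-distribˡ-sum; ∑-comm)

private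
  variable
    a b k n r t : ℕ
    A : Set

sumF≡sum : (f : Fin n → ℤ) → sumF f ≡ sum f
sumF≡sum {zero} f = refl
sumF≡sum {suc n} f = cong (_+_ (f zero)) (sumF≡sum (tail f))

sumF-cong : {f g : Fin n → ℤ} → (∀ i → f i ≡ g i) → sumF f ≡ sumF g
sumF-cong {f = f} {g} f≗g = trans (sumF≡sum f) (trans (sum-cong-≗ f≗g) (sym (sumF≡sum g)))

sumF-zero : (f : Fin n → ℤ) → (∀ i → f i ≡ + 0) → sumF f ≡ + 0
sumF-zero {zero} f f≗0 = refl
sumF-zero {suc n} f f≗0 = cong₂ _+_ (f≗0 zero) (sumF-zero (tail f) (f≗0 ∘ suc))

sumF-distrib-+ : (f g : Fin n → ℤ) → sumF (λ i → f i + g i) ≡ sumF f + sumF g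
sumF-distrib-+ f g = begin
  sumF (λ i → f i + g i) ≡⟨ sumF≡sum (λ i → f i + g i) ⟩
  sum (λ i → f i + g i)  ≡⟨ ∑-distrib-+ f g ⟩
  sum f + sum g          ≡⟨ sym (cong₂ _+_ (sumF≡sum f) (sumF≡sum g)) ⟩
  sumF f + sumF g        ∎
  where open ≡-Reasoning

*-distribˡ-sumF : (x : ℤ) (f : Fin n → ℤ) → x * sumF f ≡ sumF (λ i → x * f i)
*-distribˡ-sumF x f = begin
  x * sumF f              ≡⟨ cong (x *_) (sumF≡sum f) ⟩
  x * sum f               ≡⟨ *-distribˡ-sum x f ⟩
  sum (λ i → x * f i)     ≡⟨ sym (sumF≡sum (λ i → x * f i)) ⟩
  sumF (λ i → x * f i)    ∎
  where open ≡-Reasoning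

sumF-comm : (f : Fin a → Fin b → ℤ) → sumF (λ i → sumF (f i)) ≡ sumF (λ j → sumF (λ i → f i j))
sumF-comm f = begin
  sumF (λ i → sumF (f i))               ≡⟨ trans (sumF-cong (λ i → sumF≡sum (f i))) (sumF≡sum (λ i → sum (f i))) ⟩
  sum (λ i → sum (f i))                 ≡⟨ ∑-comm f ⟩
  sum (λ j → sum (λ i → f i j))         ≡⟨ trans (sumF-cong (λ j → sumF≡sum (λ i → f i j))) (sumF≡sum (λ j → sum (λ i → f i j))) ⟨
  sumF (λ j → sumF (λ i → f i j))       ∎
  where open ≡-Reasoning

sumF-distrib-- : (f g : Fin n → ℤ) → sumF (λ i → f i - g i) ≡ sumF f - sumF g
sumF-distrib-- f g = begin
  sumF (λ i → f i - g i)            ≡⟨ sumF-distrib-+ f (λ i → - g i) ⟩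
  sumF f + sumF (λ i → - g i)       ≡⟨ cong (_+_ (sumF f)) (sumF-cong (λ i → -x≡-1*x (g i))) ⟩
  sumF f + sumF (λ i → - + 1 * g i) ≡⟨ cong (_+_ (sumF f)) (*-distribˡ-sumF (- + 1) g) ⟨
  sumF f + - + 1 * sumF g           ≡⟨ cong (_+_ (sumF f)) (-x≡-1*x (sumF g)) ⟨
  sumF f - sumF g                   ∎
  where
  open ≡-Reasoning
  -x≡-1*x : ∀ x → - x ≡ - + 1 * x
  -x≡-1*x = solve-∀

*-distribʳ-sumF : (x : ℤ) (f : Fin n → ℤ) → sumF f * x ≡ sumF (λ i → f i * x)
*-distribʳ-sumF x f = trans (ℤ.*-comm (sumF f) x) (trans (*-distribˡ-sumF x f) (sumF-cong (λ i → ℤ.*-comm x (f i))))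

sumF-assoc : (a : Fin n → ℤ) (N : Mat n k) (u : Fin k → ℤ) →
  sumF (λ i → a i * sumF (λ r → N i r * u r)) ≡ sumF (λ r → sumF (λ i → a i * N i r) * u r)
sumF-assoc a N u = begin
  sumF (λ i → a i * sumF (λ r → N i r * u r))   ≡⟨ sumF-cong (λ i → *-distribˡ-sumF (a i) (λ r → N i r * u r)) ⟩
  sumF (λ i → sumF (λ r → a i * (N i r * u r))) ≡⟨ sumF-cong (λ i → sumF-cong (λ r → ℤ.*-assoc (a i) (N i r) (u r))) ⟨
  sumF (λ i → sumF (λ r → a i * N i r * u r))   ≡⟨ sumF-comm (λ i r → a i * N i r * u r) ⟩
  sumF (λ r → sumF (λ i → a i * N i r * u r))   ≡⟨ sumF-cong (λ r → *-distribʳ-sumF (u r) (λ i → a i * N i r)) ⟨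
  sumF (λ r → sumF (λ i → a i * N i r) * u r)   ∎
  where open ≡-Reasoning

sumF-idMatˡ : (i : Fin n) (f : Fin n → ℤ) → sumF (λ l → idMat i l * f l) ≡ f i
sumF-idMatˡ zero f = begin
  + 1 * f zero + sumF (λ l → + 0 * f (suc l)) ≡⟨ cong₂ _+_ (ℤ.*-identityˡ (f zero)) (sumF-zero _ (λ l → ℤ.*-zeroˡ (f (suc l)))) ⟩
  f zero + + 0                                ≡⟨ ℤ.+-identityʳ (f zero) ⟩
  f zero                                      ∎
  where open ≡-Reasoning
sumF-idMatˡ (suc i) f = begin
  + 0 * f zero + sumF (λ l → idMat i l * f (suc l)) ≡⟨ cong (_+ sumF (λ l → idMat i l * f (suc l))) (ℤ.*-zeroˡ (f zero)) ⟩
  + 0 + sumF (λ l → idMat i l * f (suc l))          ≡⟨ ℤ.+-identityˡ _ ⟩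
  sumF (λ l → idMat i l * f (suc l))                ≡⟨ sumF-idMatˡ i (tail f) ⟩
  f (suc i)                                         ∎
  where open ≡-Reasoning

sumF-idMatʳ : (i : Fin n) (f : Fin n → ℤ) → sumF (λ l → f l * idMat l i) ≡ f i
sumF-idMatʳ i f = trans (sumF-cong (λ l → trans (ℤ.*-comm (f l) _) (cong (_* f l) (idMat-sym l i)))) (sumF-idMatˡ i f)
  where
  idMat-sym : (i j : Fin k) → idMat {k} i j ≡ idMat j i
  idMat-sym zero    zero    = refl
  idMat-sym zero    (suc j) = refl
  idMat-sym (suc i) zero    = refl
  idMat-sym (suc i) (suc j) = idMat-sym i j

sumMaps : ((Fin t → Fin r) → ℤ) → ℤ
sumMaps {zero}  G = G (λ ())
sumMaps {suc t} G = sumF (λ x → sumMaps (λ h → G (x ∷ h)))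

sumMaps-cong : {G H : (Fin t → Fin r) → ℤ} → (∀ h → G h ≡ H h) → sumMaps G ≡ sumMaps H
sumMaps-cong {zero}  G≗H = G≗H _
sumMaps-cong {suc t} G≗H = sumF-cong (λ x → sumMaps-cong (λ h → G≗H (x ∷ h)))

sumMaps-zero : (G : (Fin t → Fin r) → ℤ) → (∀ h → G h ≡ + 0) → sumMaps G ≡ + 0
sumMaps-zero {zero}  G G≗0 = G≗0 _
sumMaps-zero {suc t} G G≗0 = sumF-zero _ (λ x → sumMaps-zero _ (λ h → G≗0 (x ∷ h)))

*-distribˡ-sumMaps : (x : ℤ) (G : (Fin t → Fin r) → ℤ) → x * sumMaps G ≡ sumMaps (λ h → x * G h)
*-distribˡ-sumMaps {zero}  x G = refl
*-distribˡ-sumMaps {suc t} x G =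
  trans (*-distribˡ-sumF x (λ y → sumMaps (λ h → G (y ∷ h)))) (sumF-cong (λ y → *-distribˡ-sumMaps x (λ h → G (y ∷ h))))

infix 4 _≡_[mod_]
record _≡_[mod_] (x y d : ℤ) : Set where
  constructor mod
  field divides : d ∣ x - y

module _ {d : ℤ} where

  ≡-mod-reflexive : {x y : ℤ} → x ≡ y → x ≡ y [mod d ]
  ≡-mod-reflexive {x} refl = mod (∣.divides (+ 0) (trans (ℤ.+-inverseʳ x) (sym (ℤ.*-zeroˡ d))))

  ≡-mod-refl : {x : ℤ} → x ≡ x [mod d ]
  ≡-mod-refl = ≡-mod-reflexive refl

  ≡-mod-sym : {x y : ℤ} → x ≡ y [mod d ] → y ≡ x [mod d ]
  ≡-mod-sym {x} {y} (mod d∣x-y) = mod (subst (d ∣_) (ring x y) (∣.∣m⇒∣-m d∣x-y))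
    where ring : ∀ x y → - (x - y) ≡ y - x
          ring = solve-∀

  ≡-mod-trans : {x y z : ℤ} → x ≡ y [mod d ] → y ≡ z [mod d ] → x ≡ z [mod d ]
  ≡-mod-trans {x} {y} {z} (mod d∣x-y) (mod d∣y-z) = mod (subst (d ∣_) (ring x y z) (∣.∣m∣n⇒∣m+n d∣x-y d∣y-z))
    where ring : ∀ x y z → (x - y) + (y - z) ≡ x - z
          ring = solve-∀

  +-cong-mod : {x x′ y y′ : ℤ} → x ≡ x′ [mod d ] → y ≡ y′ [mod d ] → x + y ≡ x′ + y′ [mod d ]
  +-cong-mod {x} {x′} {y} {y′} (mod d∣x-x′) (mod d∣y-y′) =
    mod (subst (d ∣_) (ring x x′ y y′) (∣.∣m∣n⇒∣m+n d∣x-x′ d∣y-y′))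
    where ring : ∀ x x′ y y′ → (x - x′) + (y - y′) ≡ (x + y) - (x′ + y′)
          ring = solve-∀

  -‿cong-mod : {x x′ : ℤ} → x ≡ x′ [mod d ] → - x ≡ - x′ [mod d ]
  -‿cong-mod {x} {x′} (mod d∣x-x′) = mod (subst (d ∣_) (ring x x′) (∣.∣m⇒∣-m d∣x-x′))
    where ring : ∀ x x′ → - (x - x′) ≡ - x - - x′
          ring = solve-∀

  *-cong-mod : {x x′ y y′ : ℤ} → x ≡ x′ [mod d ] → y ≡ y′ [mod d ] → x * y ≡ x′ * y′ [mod d ]
  *-cong-mod {x} {x′} {y} {y′} (mod d∣x-x′) (mod d∣y-y′) =
    mod (subst (d ∣_) (ring x x′ y y′) (∣.∣m∣n⇒∣m+n (∣.∣m⇒∣m*n y d∣x-x′) (∣.∣n⇒∣m*n x′ d∣y-y′)))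
    where ring : ∀ x x′ y y′ → (x - x′) * y + x′ * (y - y′) ≡ x * y - x′ * y′
          ring = solve-∀

  +-congˡ-mod : ∀ x {y y′ : ℤ} → y ≡ y′ [mod d ] → x + y ≡ x + y′ [mod d ]
  +-congˡ-mod x = +-cong-mod (≡-mod-refl {x})

  *-congˡ-mod : ∀ x {y y′ : ℤ} → y ≡ y′ [mod d ] → x * y ≡ x * y′ [mod d ]
  *-congˡ-mod x = *-cong-mod (≡-mod-refl {x})

  *-congʳ-mod : ∀ y {x x′ : ℤ} → x ≡ x′ [mod d ] → x * y ≡ x′ * y [mod d ]
  *-congʳ-mod y x≈x′ = *-cong-mod x≈x′ (≡-mod-refl {y})

  sumF-cong-mod : {f g : Fin n → ℤ} → (∀ i → f i ≡ g i [mod d ]) → sumF f ≡ sumF g [mod d ]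
  sumF-cong-mod {zero}  f≈g = ≡-mod-refl
  sumF-cong-mod {suc n} f≈g = +-cong-mod (f≈g zero) (sumF-cong-mod (f≈g ∘ suc))

  ∣⇒≡0-mod : {x : ℤ} → d ∣ x → x ≡ + 0 [mod d ]
  ∣⇒≡0-mod {x} d∣x = mod (subst (d ∣_) (sym (ℤ.+-identityʳ x)) d∣x)

  ≡0-mod⇒∣ : {x : ℤ} → x ≡ + 0 [mod d ] → d ∣ x
  ≡0-mod⇒∣ {x} (mod d∣x-0) = subst (d ∣_) (ℤ.+-identityʳ x) d∣x-0

  ≡-mod-setoid : Setoid _ _
  ≡-mod-setoid = record
    { Carrier = ℤ
    ; _≈_ = λ x y → x ≡ y [mod d ]
    ; isEquivalence = record { refl = ≡-mod-refl ; sym = ≡-mod-sym ; trans = ≡-mod-trans }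
    }

≡-mod-weaken : {d e x y : ℤ} → d ∣ e → x ≡ y [mod e ] → x ≡ y [mod d ]
≡-mod-weaken d∣e (mod e∣x-y) = mod (∣.∣-trans d∣e e∣x-y)

≈⇒≡-mod : ∀ {q x y} → x ≈[ q ] y → x ≡ y [mod + q ]
≈⇒≡-mod q∣x-y = mod (∣.∣ᵤ⇒∣ q∣x-y)

MatEq⇒≡-mod : ∀ {q a b} {M M′ : Mat a b} → MatEq q M M′ → ∀ i j → M i j ≡ M′ i j [mod + q ]
MatEq⇒≡-mod M≈M′ i j = ≈⇒≡-mod (M≈M′ i j)

≡-mod⇒≈ : ∀ {q x y} → x ≡ y [mod + q ] → x ≈[ q ] y
≡-mod⇒≈ (mod q∣x-y) = ∣.∣⇒∣ᵤ q∣x-y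

module ≡-mod-Reasoning (d : ℤ) = Relation.Binary.Reasoning.Setoid (≡-mod-setoid {d})

∃¬∣-term : (d : ℤ) (f : Fin n → ℤ) → ¬ d ∣ sumF f → ∃ λ i → ¬ d ∣ f i
∃¬∣-term {n} d f d∤Σf = Fin.¬∀⟶∃¬ n _ (λ i → d ∣? f i)
  (λ d∣f → d∤Σf (≡0-mod⇒∣ (≡-mod-trans (sumF-cong-mod (∣⇒≡0-mod ∘ d∣f))
                                        (≡-mod-reflexive (sumF-zero {n} _ (λ _ → refl))))))

∃¬∣-termMaps : (d : ℤ) (G : (Fin t → Fin r) → ℤ) → ¬ d ∣ sumMaps G → ∃ λ h → ¬ d ∣ G h
∃¬∣-termMaps {zero}  d G d∤ΣG = _ , d∤ΣG
∃¬∣-termMaps {suc t} d G d∤ΣG with ∃¬∣-term d _ d∤ΣG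
... | x , d∤Gx with ∃¬∣-termMaps d (λ h → G (x ∷ h)) d∤Gx
...   | h , d∤Gxh = x ∷ h , d∤Gxh

-- Determinants as multilinear alternating functions of the columns

det-cong : {M N : Mat k k} → (∀ i j → M i j ≡ N i j) → det M ≡ det N
det-cong {zero}  M≗N = refl
det-cong {suc k} M≗N =
  sumF-cong (λ j → cong₂ (λ x y → sign j * (x * y)) (M≗N zero j) (det-cong (λ a b → M≗N (suc a) (Fin.punchIn j b))))

det-cong-mod : {d : ℤ} {M N : Mat k k} → (∀ i j → M i j ≡ N i j [mod d ]) → det M ≡ det N [mod d ]
det-cong-mod {zero}  M≈N = ≡-mod-refl
det-cong-mod {suc k} M≈N =
  sumF-cong-mod (λ j → *-congˡ-mod (sign j) (*-cong-mod (M≈N zero j) (det-cong-mod (λ a b → M≈N (suc a) (Fin.punchIn j b)))))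

det-idMat : det (idMat {k}) ≡ + 1
det-idMat {zero}  = refl
det-idMat {suc k} = begin
  + 1 * (+ 1 * det (idMat {k})) + sumF (λ j → sign (suc j) * (+ 0 * det (minorOfId j)))
    ≡⟨ cong₂ _+_ (trans (ℤ.*-identityˡ _) (trans (ℤ.*-identityˡ _) (det-idMat {k})))
                 (sumF-zero _ (λ j → trans (cong (sign (suc j) *_) (ℤ.*-zeroˡ (det (minorOfId j)))) (ℤ.*-zeroʳ (sign (suc j))))) ⟩
  + 1 + + 0
    ≡⟨⟩
  + 1 ∎
  where
  open ≡-Reasoning
  minorOfId : Fin k → Mat k k
  minorOfId j a b = idMat {suc k} (suc a) (Fin.punchIn (suc j) b)

detᵀ : Mat k k → ℤ
detᵀ C = det (transpose C)

minorᵀ : Mat (suc k) (suc k) → Fin (suc k) → Mat k k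
minorᵀ C j = map tail (removeAt C j)

infixl 6 _[_]≔_
_[_]≔_ : Vector A n → Fin n → A → Vector A n
xs [ c ]≔ x = updateAt xs c (const x)

minorᵀ-updateAt-self : (C : Mat (suc k) (suc k)) (c : Fin (suc k)) (u : Vect (suc k)) →
  ∀ b i → minorᵀ (C [ c ]≔ u) c b i ≡ minorᵀ C c b i
minorᵀ-updateAt-self C c u b i =
  cong (λ col → col (suc i)) (updateAt-minimal (Fin.punchIn c b) c C (Fin.punchInᵢ≢i c b))

minorᵀ-updateAt : (C : Mat (suc k) (suc k)) {c j : Fin (suc k)} (u : Vect (suc k)) (j≢c : j ≢ c) →
  ∀ b i → minorᵀ (C [ c ]≔ u) j b i ≡ (minorᵀ C j [ Fin.punchOut j≢c ]≔ tail u) b i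
minorᵀ-updateAt C {c} {j} u j≢c b i with b Fin.≟ Fin.punchOut j≢c
... | yes refl = begin
  (C [ c ]≔ u) (Fin.punchIn j (Fin.punchOut j≢c)) (suc i) ≡⟨ cong (λ l → (C [ c ]≔ u) l (suc i)) (Fin.punchIn-punchOut j≢c) ⟩
  (C [ c ]≔ u) c (suc i)                                  ≡⟨ cong (λ col → col (suc i)) (updateAt-updates c C) ⟩
  u (suc i)                                               ≡⟨ cong (λ col → col i) (updateAt-updates b (minorᵀ C j)) ⟨
  (minorᵀ C j [ b ]≔ tail u) b i                          ∎
  where open ≡-Reasoning
... | no b≢c′ = trans (cong (λ col → col (suc i)) (updateAt-minimal (Fin.punchIn j b) c C punchIn≢c))
                      (sym (cong (λ col → col i) (updateAt-minimal b (Fin.punchOut j≢c) (minorᵀ C j) b≢c′)))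
  where
  punchIn≢c : Fin.punchIn j b ≢ c
  punchIn≢c eq = b≢c′ (Fin.punchIn-injective j b _ (trans eq (sym (Fin.punchIn-punchOut j≢c))))

detᵀ-linear : (C : Mat k k) (c : Fin k) (α : ℤ) (x y : Vect k) →
  detᵀ (C [ c ]≔ (λ i → α * x i + y i)) ≡ α * detᵀ (C [ c ]≔ x) + detᵀ (C [ c ]≔ y)
detᵀ-linear {suc k} C c α x y = begin
  sumF (term v)                             ≡⟨ sumF-cong termwise ⟩
  sumF (λ j → α * term x j + term y j)      ≡⟨ sumF-distrib-+ (λ j → α * term x j) (term y) ⟩
  sumF (λ j → α * term x j) + sumF (term y) ≡⟨ cong (_+ sumF (term y)) (*-distribˡ-sumF α (term x)) ⟨
  α * sumF (term x) + sumF (term y)         ∎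
  where
  open ≡-Reasoning
  v : Vect (suc k)
  v i = α * x i + y i
  term : Vect (suc k) → Fin (suc k) → ℤ
  term u j = sign j * ((C [ c ]≔ u) j zero * detᵀ (minorᵀ (C [ c ]≔ u) j))
  termwise : ∀ j → term v j ≡ α * term x j + term y j
  termwise j with j Fin.≟ c
  ... | yes refl = begin
    term v j                                                                    ≡⟨ updated v ⟩
    sign j * ((α * x zero + y zero) * detᵀ (minorᵀ C j))                        ≡⟨ ring (sign j) α (x zero) (y zero) _ ⟩
    α * (sign j * (x zero * detᵀ (minorᵀ C j))) + sign j * (y zero * detᵀ (minorᵀ C j))
                                                                                ≡⟨ cong₂ (λ X Y → α * X + Y) (updated x) (updated y) ⟨
    α * term x j + term y j                                                     ∎
    where
    ring : ∀ s α x y D → s * ((α * x + y) * D) ≡ α * (s * (x * D)) + s * (y * D)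
    ring = solve-∀
    updated : ∀ u → term u j ≡ sign j * (u zero * detᵀ (minorᵀ C j))
    updated u = cong₂ (λ e D → sign j * (e * D)) (cong (λ col → col zero) (updateAt-updates j C))
                                                 (det-cong (λ i b → minorᵀ-updateAt-self C j u b i))
  ... | no j≢c = begin
    term v j                                                          ≡⟨ untouched v ⟩
    sign j * (C j zero * detᵀ (minorᵀ C j [ c′ ]≔ tail v))
                                                                      ≡⟨ cong (λ D → sign j * (C j zero * D)) (detᵀ-linear (minorᵀ C j) c′ α (tail x) (tail y)) ⟩
    sign j * (C j zero * (α * detᵀ (minorᵀ C j [ c′ ]≔ tail x) + detᵀ (minorᵀ C j [ c′ ]≔ tail y)))
                                                                      ≡⟨ ring (sign j) (C j zero) α _ _ ⟩
    α * (sign j * (C j zero * detᵀ (minorᵀ C j [ c′ ]≔ tail x))) + sign j * (C j zero * detᵀ (minorᵀ C j [ c′ ]≔ tail y))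
                                                                      ≡⟨ cong₂ (λ X Y → α * X + Y) (untouched x) (untouched y) ⟨
    α * term x j + term y j                                           ∎
    where
    c′ : Fin k
    c′ = Fin.punchOut j≢c
    ring : ∀ s m α dx dy → s * (m * (α * dx + dy)) ≡ α * (s * (m * dx)) + s * (m * dy)
    ring = solve-∀
    untouched : ∀ u → term u j ≡ sign j * (C j zero * detᵀ (minorᵀ C j [ c′ ]≔ tail u))
    untouched u = cong₂ (λ e D → sign j * (e * D)) (cong (λ col → col zero) (updateAt-minimal j c C j≢c))
                                                   (det-cong (λ i b → minorᵀ-updateAt C u j≢c b i))

record Multilinear {t k} (F : Mat t k → ℤ) : Set where
  field
    F-cong : {C C′ : Mat t k} → (∀ j i → C j i ≡ C′ j i) → F C ≡ F C′
    linear : ∀ C c α (x y : Vect k) → F (C [ c ]≔ (λ i → α * x i + y i)) ≡ α * F (C [ c ]≔ x) + F (C [ c ]≔ y)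

detᵀ-multilinear : Multilinear (detᵀ {k})
detᵀ-multilinear = record { F-cong = λ C≗C′ → det-cong (λ i j → C≗C′ j i) ; linear = detᵀ-linear }

module _ {F : Mat t k → ℤ} (F-multilinear : Multilinear F) where
  open Multilinear F-multilinear

  multilinear-zero : ∀ C c → F (C [ c ]≔ (λ _ → + 0)) ≡ + 0
  multilinear-zero C c = trans (linear C c (- + 1) zeros zeros) (ring (F (C [ c ]≔ zeros)))
    where
    zeros : Vect k
    zeros _ = + 0
    ring : ∀ z → - + 1 * z + z ≡ + 0
    ring = solve-∀

  multilinear-sum : ∀ C c (β : Fin r → ℤ) (x : Fin r → Vect k) →
    F (C [ c ]≔ (λ i → sumF (λ l → β l * x l i))) ≡ sumF (λ l → β l * F (C [ c ]≔ x l))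
  multilinear-sum {zero}  C c β x = multilinear-zero C c
  multilinear-sum {suc r} C c β x =
    trans (linear C c (β zero) (x zero) (λ i → sumF (λ l → β (suc l) * x (suc l) i)))
          (cong (_+_ (β zero * F (C [ c ]≔ x zero))) (multilinear-sum C c (β ∘ suc) (x ∘ suc)))

multilinear-cons : {F : Mat (suc t) k → ℤ} → Multilinear F → ∀ x → Multilinear (λ C → F (x ∷ C))
multilinear-cons {F = F} F-multilinear x = record
  { F-cong = λ C≗C′ → F-cong (λ { zero i → refl ; (suc j) i → C≗C′ j i })
  ; linear = λ C c α y z → trans (F-cong cons-update) (trans (linear (x ∷ C) (suc c) α y z)
                 (sym (cong₂ (λ Y Z → α * Y + Z) (F-cong cons-update) (F-cong cons-update))))
  }
  where
  open Multilinear F-multilinear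
  cons-update : ∀ {C c u} j i → (x ∷ (C [ c ]≔ u)) j i ≡ ((x ∷ C) [ suc c ]≔ u) j i
  cons-update zero    i = refl
  cons-update (suc j) i = refl

multilinear-expand : ∀ {t k r} {F : Mat t k → ℤ} → Multilinear F → (B : Mat r t) (x : Mat r k) →
  F (λ j i → sumF (λ l → B l j * x l i)) ≡ sumMaps (λ h → product (λ j → B (h j) j) * F (λ j → x (h j)))
multilinear-expand {zero} F-multilinear B x = trans (F-cong (λ ())) (sym (ℤ.*-identityˡ _))
  where open Multilinear F-multilinear
multilinear-expand {suc t} {k} {r} {F} F-multilinear B x = begin
  F C                                                     ≡⟨ F-cong first-column ⟩
  F (C [ zero ]≔ C zero)                                  ≡⟨ multilinear-sum F-multilinear C zero (λ l → B l zero) x ⟩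
  sumF (λ l → B l zero * F (C [ zero ]≔ x l))              ≡⟨ sumF-cong (λ l → cong (B l zero *_) (F-cong (replace l))) ⟩
  sumF (λ l → B l zero * F (x l ∷ tail C))                 ≡⟨ sumF-cong (λ l → cong (B l zero *_) (expand-rest l)) ⟩
  sumF (λ l → B l zero * sumMaps (λ h → product (λ j → B (h j) (suc j)) * F (x l ∷ (λ j → x (h j)))))
    ≡⟨ sumF-cong (λ l → trans (*-distribˡ-sumMaps {t} (B l zero) _) (sumMaps-cong {t} (λ h → sym (ℤ.*-assoc (B l zero) _ _)))) ⟩
  sumF (λ l → sumMaps (λ h → B l zero * product (λ j → B (h j) (suc j)) * F (x l ∷ (λ j → x (h j)))))
    ≡⟨ sumF-cong (λ l → sumMaps-cong (λ h → cong (B l zero * product (λ j → B (h j) (suc j)) *_) (F-cong (cons l h)))) ⟩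
  sumMaps (λ h → product (λ j → B (h j) j) * F (λ j → x (h j))) ∎
  where
  open ≡-Reasoning
  open Multilinear F-multilinear
  C : Mat (suc t) k
  C j i = sumF (λ l → B l j * x l i)
  first-column : ∀ j i → C j i ≡ (C [ zero ]≔ C zero) j i
  first-column zero    i = refl
  first-column (suc j) i = refl
  replace : ∀ l j i → (C [ zero ]≔ x l) j i ≡ (x l ∷ tail C) j i
  replace l zero    i = refl
  replace l (suc j) i = refl
  expand-rest : ∀ l → F (x l ∷ tail C) ≡ sumMaps (λ h → product (λ j → B (h j) (suc j)) * F (x l ∷ (λ j → x (h j))))
  expand-rest l = multilinear-expand (multilinear-cons F-multilinear (x l)) (λ l′ j → B l′ (suc j)) x
  cons : ∀ l h j i → (x l ∷ (λ j → x (h j))) j i ≡ x ((l ∷ h) j) i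
  cons l h zero    i = refl
  cons l h (suc j) i = refl

det-⊗-expand : (C : Mat k r) (D : Mat r k) →
  det (C ⊗ D) ≡ sumMaps (λ h → product (λ j → D (h j) j) * det (λ i j → C i (h j)))
det-⊗-expand C D = trans (det-cong (λ i j → sumF-cong (λ l → ℤ.*-comm (C i l) (D l j))))
  (multilinear-expand detᵀ-multilinear D (transpose C))

[]≔-cong : (C : Mat n k) (c : Fin n) {u v : Vect k} → (∀ i → u i ≡ v i) → ∀ j i → (C [ c ]≔ u) j i ≡ (C [ c ]≔ v) j i
[]≔-cong C c u≗v j i with j Fin.≟ c
... | yes refl = trans (cong (λ col → col i) (updateAt-updates j C)) (trans (u≗v i) (sym (cong (λ col → col i) (updateAt-updates j C))))
... | no j≢c = trans (cong (λ col → col i) (updateAt-minimal j c C j≢c)) (sym (cong (λ col → col i) (updateAt-minimal j c C j≢c)))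

detᵀ-additive : (C : Mat k k) (c : Fin k) (x y : Vect k) →
  detᵀ (C [ c ]≔ (λ i → x i + y i)) ≡ detᵀ (C [ c ]≔ x) + detᵀ (C [ c ]≔ y)
detᵀ-additive C c x y = begin
  detᵀ (C [ c ]≔ (λ i → x i + y i))         ≡⟨ det-cong (λ i j → []≔-cong C c (λ l → cong (_+ y l) (ℤ.*-identityˡ (x l))) j i) ⟨
  detᵀ (C [ c ]≔ (λ i → + 1 * x i + y i))   ≡⟨ detᵀ-linear C c (+ 1) x y ⟩
  + 1 * detᵀ (C [ c ]≔ x) + detᵀ (C [ c ]≔ y) ≡⟨ cong (_+ detᵀ (C [ c ]≔ y)) (ℤ.*-identityˡ (detᵀ (C [ c ]≔ x))) ⟩
  detᵀ (C [ c ]≔ x) + detᵀ (C [ c ]≔ y)     ∎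
  where open ≡-Reasoning

punchIn-adjacent : (a b : Fin k) →
  Fin.punchIn (Fin.inject₁ a) b ≡ Fin.punchIn (suc a) b ⊎
  (Fin.punchIn (Fin.inject₁ a) b ≡ suc a × Fin.punchIn (suc a) b ≡ Fin.inject₁ a)
punchIn-adjacent zero    zero    = inj₂ (refl , refl)
punchIn-adjacent zero    (suc b) = inj₁ refl
punchIn-adjacent (suc a) zero    = inj₁ refl
punchIn-adjacent (suc a) (suc b) with punchIn-adjacent a b
... | inj₁ eq          = inj₁ (cong suc eq)
... | inj₂ (eq₁ , eq₂) = inj₂ (cong suc eq₁ , cong suc eq₂)

adjacent-punchOut : (j : Fin (suc (suc k))) (a : Fin (suc k)) → j ≢ Fin.inject₁ a → j ≢ suc a →
  ∃ λ a′ → Fin.punchIn j (Fin.inject₁ a′) ≡ Fin.inject₁ a × Fin.punchIn j (suc a′) ≡ suc a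
adjacent-punchOut zero          zero     j≢a _   = contradiction refl j≢a
adjacent-punchOut zero          (suc a)  _   _   = a , refl , refl
adjacent-punchOut (suc zero)    zero     _   j≢a = contradiction refl j≢a
adjacent-punchOut {suc k} (suc (suc j)) zero _ _ = zero , refl , refl
adjacent-punchOut {suc k} (suc j) (suc a) j≢a j≢a+1
  with a′ , eq₁ , eq₂ ← adjacent-punchOut j a (j≢a ∘ cong suc) (j≢a+1 ∘ cong suc)
  = suc a′ , cong suc eq₁ , cong suc eq₂

sumF-adjacent-pair : (f : Fin (suc (suc k)) → ℤ) (a : Fin (suc k)) →
  (∀ j → j ≢ Fin.inject₁ a → j ≢ suc a → f j ≡ + 0) → f (Fin.inject₁ a) + f (suc a) ≡ + 0 → sumF f ≡ + 0
sumF-adjacent-pair {k} f zero others pair = begin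
  f zero + (f (suc zero) + sumF (λ j → f (suc (suc j)))) ≡⟨ ℤ.+-assoc (f zero) (f (suc zero)) (sumF (λ j → f (suc (suc j)))) ⟨
  f zero + f (suc zero) + sumF (λ j → f (suc (suc j)))   ≡⟨ cong₂ _+_ pair (sumF-zero {k} _ (λ j → others (suc (suc j)) (λ ()) (λ ()))) ⟩
  + 0                                            ∎
  where open ≡-Reasoning
sumF-adjacent-pair {suc k} f (suc a) others pair =
  cong₂ _+_ (others zero (λ ()) (λ ()))
    (sumF-adjacent-pair (f ∘ suc) a (λ j j≢a j≢a+1 → others (suc j) (j≢a ∘ Fin.suc-injective) (j≢a+1 ∘ Fin.suc-injective)) pair)

-- In the Laplace expansion the terms at the two equal columns cancel, and every other minor
-- still has two adjacent equal columns.
detᵀ-adjacent : (C : Mat (suc k) (suc k)) (a : Fin k) → (∀ i → C (Fin.inject₁ a) i ≡ C (suc a) i) → detᵀ C ≡ + 0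
detᵀ-adjacent {suc k} C a Ca≗Ca+1 = sumF-adjacent-pair term a others pair
  where
  term : Fin (suc (suc k)) → ℤ
  term j = sign j * (C j zero * detᵀ (minorᵀ C j))
  others : ∀ j → j ≢ Fin.inject₁ a → j ≢ suc a → term j ≡ + 0
  others j j≢a j≢a+1 with a′ , eq₁ , eq₂ ← adjacent-punchOut j a j≢a j≢a+1 = begin
    sign j * (C j zero * detᵀ (minorᵀ C j)) ≡⟨ cong (λ D → sign j * (C j zero * D)) (detᵀ-adjacent (minorᵀ C j) a′ minor-adjacent) ⟩
    sign j * (C j zero * + 0)             ≡⟨ cong (sign j *_) (ℤ.*-zeroʳ (C j zero)) ⟩
    sign j * + 0                          ≡⟨ ℤ.*-zeroʳ (sign j) ⟩
    + 0                                   ∎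
    where
    open ≡-Reasoning
    minor-adjacent : ∀ i → minorᵀ C j (Fin.inject₁ a′) i ≡ minorᵀ C j (suc a′) i
    minor-adjacent i = trans (cong (λ l → C l (suc i)) eq₁) (trans (Ca≗Ca+1 (suc i)) (cong (λ l → C l (suc i)) (sym eq₂)))
  same-minor : ∀ b i → minorᵀ C (Fin.inject₁ a) b i ≡ minorᵀ C (suc a) b i
  same-minor b i with punchIn-adjacent a b
  ... | inj₁ eq          = cong (λ l → C l (suc i)) eq
  ... | inj₂ (eq₁ , eq₂) = trans (cong (λ l → C l (suc i)) eq₁) (trans (sym (Ca≗Ca+1 (suc i))) (cong (λ l → C l (suc i)) (sym eq₂)))
  sign-inject₁ : ∀ {k} (a : Fin k) → sign (Fin.inject₁ a) ≡ sign a
  sign-inject₁ zero    = refl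
  sign-inject₁ (suc a) = cong -_ (sign-inject₁ a)
  pair : term (Fin.inject₁ a) + term (suc a) ≡ + 0
  pair = begin
    sign (Fin.inject₁ a) * (C (Fin.inject₁ a) zero * detᵀ (minorᵀ C (Fin.inject₁ a))) + - sign a * (C (suc a) zero * detᵀ (minorᵀ C (suc a)))
      ≡⟨ cong₂ (λ s x → s * (x * detᵀ (minorᵀ C (Fin.inject₁ a))) + - sign a * (C (suc a) zero * detᵀ (minorᵀ C (suc a))))
               (sign-inject₁ a) (Ca≗Ca+1 zero) ⟩
    sign a * (C (suc a) zero * detᵀ (minorᵀ C (Fin.inject₁ a))) + - sign a * (C (suc a) zero * detᵀ (minorᵀ C (suc a)))
      ≡⟨ cong (λ D → sign a * (C (suc a) zero * detᵀ (minorᵀ C (Fin.inject₁ a))) + - sign a * (C (suc a) zero * D))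
              (det-cong (λ i b → same-minor b i)) ⟨
    sign a * (C (suc a) zero * detᵀ (minorᵀ C (Fin.inject₁ a))) + - sign a * (C (suc a) zero * detᵀ (minorᵀ C (Fin.inject₁ a)))
      ≡⟨ ring (sign a) (C (suc a) zero) (detᵀ (minorᵀ C (Fin.inject₁ a))) ⟩
    + 0 ∎
    where
    open ≡-Reasoning
    ring : ∀ s x D → s * (x * D) + - s * (x * D) ≡ + 0
    ring = solve-∀

alternating⇒antisymmetric : {V : Set} (_⊕_ : V → V → V) (Φ : V → V → ℤ) →
  (∀ u v w → Φ (u ⊕ v) w ≡ Φ u w + Φ v w) → (∀ u v w → Φ u (v ⊕ w) ≡ Φ u v + Φ u w) →
  (∀ w → Φ w w ≡ + 0) → ∀ u v → Φ v u ≡ - Φ u v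
alternating⇒antisymmetric _⊕_ Φ additiveˡ additiveʳ alternating u v = begin
  Φ v u                   ≡⟨ ring₁ (Φ u v) (Φ v u) ⟩
  (Φ u v + Φ v u) - Φ u v ≡⟨ cong (_- Φ u v) sum≡0 ⟩
  + 0 - Φ u v             ≡⟨ ℤ.+-identityˡ (- Φ u v) ⟩
  - Φ u v                 ∎
  where
  open ≡-Reasoning
  ring₁ : ∀ x y → y ≡ (x + y) - x
  ring₁ = solve-∀
  ring₂ : ∀ x y → x + y ≡ (+ 0 + x) + (y + + 0)
  ring₂ = solve-∀
  sum≡0 : Φ u v + Φ v u ≡ + 0
  sum≡0 = begin
    Φ u v + Φ v u                     ≡⟨ ring₂ (Φ u v) (Φ v u) ⟩
    (+ 0 + Φ u v) + (Φ v u + + 0)     ≡⟨ cong₂ (λ a d → (a + Φ u v) + (Φ v u + d)) (alternating u) (alternating v) ⟨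
    (Φ u u + Φ u v) + (Φ v u + Φ v v) ≡⟨ cong₂ _+_ (additiveʳ u u v) (additiveʳ v u v) ⟨
    Φ u (u ⊕ v) + Φ v (u ⊕ v)         ≡⟨ additiveˡ u v (u ⊕ v) ⟨
    Φ (u ⊕ v) (u ⊕ v)                 ≡⟨ alternating (u ⊕ v) ⟩
    + 0                               ∎

inject₁≢suc : (a : Fin k) → Fin.inject₁ a ≢ suc a
inject₁≢suc a = Fin.<⇒≢ (Fin.≤̄⇒inject₁< Fin.≤-refl)

detᵀ-swap-adjacent : (C : Mat (suc k) (suc k)) (a : Fin k) →
  detᵀ (C [ Fin.inject₁ a ]≔ C (suc a) [ suc a ]≔ C (Fin.inject₁ a)) ≡ - detᵀ C
detᵀ-swap-adjacent {k} C a = begin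
  Φ (C a₂) (C a₁)   ≡⟨ alternating⇒antisymmetric _⊕_ Φ additiveˡ additiveʳ alternating (C a₁) (C a₂) ⟩
  - Φ (C a₁) (C a₂) ≡⟨ cong -_ (det-cong (λ i j → cong (λ col → col i) (unchanged j))) ⟩
  - detᵀ C          ∎
  where
  open ≡-Reasoning
  a₁ a₂ : Fin (suc k)
  a₁ = Fin.inject₁ a
  a₂ = suc a
  a₁≢a₂ : a₁ ≢ a₂
  a₁≢a₂ = inject₁≢suc a
  Φ : Vect (suc k) → Vect (suc k) → ℤ
  Φ u v = detᵀ (C [ a₁ ]≔ u [ a₂ ]≔ v)
  _⊕_ : Vect (suc k) → Vect (suc k) → Vect (suc k)
  u ⊕ v = λ i → u i + v i
  additiveʳ : ∀ u v w → Φ u (v ⊕ w) ≡ Φ u v + Φ u w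
  additiveʳ u = detᵀ-additive (C [ a₁ ]≔ u) a₂
  commute : ∀ u v → Φ u v ≡ detᵀ (C [ a₂ ]≔ v [ a₁ ]≔ u)
  commute u v = det-cong (λ i j → cong (λ col → col i) (updateAt-commutes a₂ a₁ {f = const v} {g = const u} (a₁≢a₂ ∘ sym) C j))
  additiveˡ : ∀ u v w → Φ (u ⊕ v) w ≡ Φ u w + Φ v w
  additiveˡ u v w = trans (commute (u ⊕ v) w)
    (trans (detᵀ-additive (C [ a₂ ]≔ w) a₁ u v) (sym (cong₂ _+_ (commute u w) (commute v w))))
  alternating : ∀ w → Φ w w ≡ + 0
  alternating w = detᵀ-adjacent (C [ a₁ ]≔ w [ a₂ ]≔ w) a (λ i → cong (λ col → col i)
    (trans (updateAt-minimal a₁ a₂ (C [ a₁ ]≔ w) a₁≢a₂) (trans (updateAt-updates a₁ C) (sym (updateAt-updates a₂ (C [ a₁ ]≔ w))))))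
  unchanged : C [ a₁ ]≔ C a₁ [ a₂ ]≔ C a₂ ≗ C
  unchanged j = trans (updateAt-id-local a₂ (C [ a₁ ]≔ C a₁) (sym (updateAt-minimal a₂ a₁ C (a₁≢a₂ ∘ sym))) j)
                      (updateAt-id-local a₁ C refl j)

-- Swapping the columns at a and a + 1 moves the right-hand copy of column i one step closer to it.
detᵀ-equal-columns-at-distance : ∀ d (C : Mat (suc k) (suc k)) (i : Fin (suc k)) (a : Fin k) →
  Fin.toℕ i ℕ.+ d ≡ Fin.toℕ a → (∀ l → C i l ≡ C (suc a) l) → detᵀ C ≡ + 0
detᵀ-equal-columns-at-distance zero C i a i+0≡a Ci≗Ca+1 =
  detᵀ-adjacent C a (λ l → trans (cong (λ c → C c l) (sym i≡a)) (Ci≗Ca+1 l))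
  where
  i≡a : i ≡ Fin.inject₁ a
  i≡a = Fin.toℕ-injective (trans (sym (ℕ.+-identityʳ (Fin.toℕ i))) (trans i+0≡a (sym (Fin.toℕ-inject₁ a))))
detᵀ-equal-columns-at-distance (suc d) C i zero i+d≡0 _ =
  contradiction i+d≡0 (ℕ.m<n⇒n≢0 (ℕ.m<m+n (Fin.toℕ i) ℕ.z<s))
detᵀ-equal-columns-at-distance {suc k} (suc d) C i (suc a) i+d≡a Ci≗Ca+1 = begin
  detᵀ C             ≡⟨ ℤ.neg-involutive (detᵀ C) ⟨
  - - detᵀ C         ≡⟨ cong -_ (detᵀ-swap-adjacent C (suc a)) ⟨
  - detᵀ swapped     ≡⟨ cong -_ (detᵀ-equal-columns-at-distance d swapped i (Fin.inject₁ a) i+d≡a′ swapped-equal) ⟩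
  + 0                ∎
  where
  open ≡-Reasoning
  a₁ a₂ : Fin (suc (suc k))
  a₁ = Fin.inject₁ (suc a)
  a₂ = suc (suc a)
  swapped : Mat (suc (suc k)) (suc (suc k))
  swapped = C [ a₁ ]≔ C a₂ [ a₂ ]≔ C a₁
  i+d≡a′ : Fin.toℕ i ℕ.+ d ≡ Fin.toℕ (Fin.inject₁ a)
  i+d≡a′ = trans (ℕ.suc-injective (trans (sym (ℕ.+-suc (Fin.toℕ i) d)) i+d≡a)) (sym (Fin.toℕ-inject₁ a))
  i<a₁ : Fin.toℕ i < Fin.toℕ a₁
  i<a₁ = subst (Fin.toℕ i ℕ.<_) (trans i+d≡a (sym (Fin.toℕ-inject₁ (suc a)))) (ℕ.m<m+n (Fin.toℕ i) ℕ.z<s)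
  i≢a₁ : i ≢ a₁
  i≢a₁ = ℕ.<⇒≢ i<a₁ ∘ cong Fin.toℕ
  i≢a₂ : i ≢ a₂
  i≢a₂ = ℕ.<⇒≢ (subst (Fin.toℕ i ℕ.<_) (cong suc (Fin.toℕ-inject₁ (suc a))) (ℕ.m<n⇒m<1+n i<a₁)) ∘ cong Fin.toℕ
  a₁≢a₂ : a₁ ≢ a₂
  a₁≢a₂ = inject₁≢suc (suc a)
  swapped-equal : ∀ l → swapped i l ≡ swapped a₁ l
  swapped-equal l = begin
    swapped i l               ≡⟨ cong (λ col → col l) (updateAt-minimal i a₂ (C [ a₁ ]≔ C a₂) i≢a₂) ⟩
    (C [ a₁ ]≔ C a₂) i l      ≡⟨ cong (λ col → col l) (updateAt-minimal i a₁ C i≢a₁) ⟩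
    C i l                     ≡⟨ Ci≗Ca+1 l ⟩
    C a₂ l                    ≡⟨ cong (λ col → col l) (updateAt-updates a₁ C) ⟨
    (C [ a₁ ]≔ C a₂) a₁ l     ≡⟨ cong (λ col → col l) (updateAt-minimal a₁ a₂ (C [ a₁ ]≔ C a₂) a₁≢a₂) ⟨
    swapped a₁ l              ∎

detᵀ-equal-columns : (C : Mat k k) {i j : Fin k} → i Fin.< j → (∀ l → C i l ≡ C j l) → detᵀ C ≡ + 0
detᵀ-equal-columns {suc k} C {i} {suc a} i<j Ci≗Cj with d , i+d≡a ← ℕ.m≤n⇒∃[o]m+o≡n (ℕ.≤-pred i<j) =
  detᵀ-equal-columns-at-distance d C i a i+d≡a Ci≗Cj

minor-repeated-column : (M : Mat k n) (g : Fin k → Fin n) {i j : Fin k} → i Fin.< j → g i ≡ g j →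
  det (λ a b → M a (g b)) ≡ + 0
minor-repeated-column M g i<j gi≡gj = detᵀ-equal-columns (λ b a → M a (g b)) i<j (λ l → cong (M l) gi≡gj)

det-⊗-vanishes : r < k → (C : Mat k r) (D : Mat r k) → det (C ⊗ D) ≡ + 0
det-⊗-vanishes r<k C D = trans (det-⊗-expand C D) (sumMaps-zero _ term≡0)
  where
  term≡0 : ∀ h → product (λ j → D (h j) j) * det (λ i j → C i (h j)) ≡ + 0
  term≡0 h with i , j , i<j , hi≡hj ← Fin.pigeonhole r<k h =
    trans (cong (product (λ j → D (h j) j) *_) (minor-repeated-column C h i<j hi≡hj))
          (ℤ.*-zeroʳ (product (λ j → D (h j) j)))

minor-columns-injective : (d : ℤ) (M : Mat k n) (g : Fin k → Fin n) → ¬ d ∣ det (λ i j → M i (g j)) → Injective _≡_ _≡_ g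
minor-columns-injective d M g d∤minor {i} {j} gi≡gj with Fin.<-cmp i j
... | tri≈ _ i≡j _ = i≡j
... | tri< i<j _ _ = contradiction (≡0-mod⇒∣ (≡-mod-reflexive (minor-repeated-column M g i<j gi≡gj))) d∤minor
... | tri> _ _ j<i = contradiction (≡0-mod⇒∣ (≡-mod-reflexive (minor-repeated-column M g j<i (sym gi≡gj)))) d∤minor

-- Units modulo a prime power

pos-lift : ∀ {b c a q} → 1 ℕ.+ b ℕ.* c ≡ a ℕ.* q → + 1 + + b * + c ≡ + a * + q
pos-lift {b} {c} {a} {q} eq = begin
  + 1 + + b * + c    ≡⟨ cong (_+_ (+ 1)) (ℤ.pos-* b c) ⟨
  + 1 + + (b ℕ.* c)  ≡⟨ ℤ.pos-+ 1 (b ℕ.* c) ⟨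
  + (1 ℕ.+ b ℕ.* c)  ≡⟨ cong +_ eq ⟩
  + (a ℕ.* q)        ≡⟨ ℤ.pos-* a q ⟩
  + a * + q          ∎
  where open ≡-Reasoning

bézout⇒inverse-mod : ∀ {q n} → Bézout.Identity 1 q n → ∃ λ y → + n * y ≡ + 1 [mod + q ]
bézout⇒inverse-mod {q} {n} (Bézout.+- a b eq) = - + b , mod (∣.divides (- + a) (begin
  + n * - + b - + 1   ≡⟨ ring (+ n) (+ b) ⟩
  - (+ 1 + + b * + n) ≡⟨ cong -_ (pos-lift {b} {n} {a} {q} eq) ⟩
  - (+ a * + q)       ≡⟨ ℤ.neg-distribˡ-* (+ a) (+ q) ⟩
  - + a * + q         ∎))
  where
  open ≡-Reasoning
  ring : ∀ n b → n * - b - + 1 ≡ - (+ 1 + b * n)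
  ring = solve-∀
bézout⇒inverse-mod {q} {n} (Bézout.-+ a b eq) = + b , mod (∣.divides (+ a) (begin
  + n * + b - + 1         ≡⟨ ring₁ (+ n) (+ b) ⟩
  + b * + n - + 1         ≡⟨ cong (_- + 1) (pos-lift {a} {q} {b} {n} eq) ⟨
  + 1 + + a * + q - + 1   ≡⟨ ring₂ (+ a * + q) ⟩
  + a * + q               ∎))
  where
  open ≡-Reasoning
  ring₁ : ∀ n b → n * b - + 1 ≡ b * n - + 1
  ring₁ = solve-∀
  ring₂ : ∀ z → + 1 + z - + 1 ≡ z
  ring₂ = solve-∀

∣x∣-inverse⇒inverse : ∀ {d x} → (∃ λ y → + ℤ.∣ x ∣ * y ≡ + 1 [mod d ]) → ∃ λ z → x * z ≡ + 1 [mod d ]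
∣x∣-inverse⇒inverse {d} {x} (y , inv) with ℤ.+∣i∣≡i⊎+∣i∣≡-i x
... | inj₁ +∣x∣≡x  = y , subst (λ z → z * y ≡ + 1 [mod d ]) +∣x∣≡x inv
... | inj₂ +∣x∣≡-x = - y , subst (_≡ + 1 [mod d ]) (trans (cong (_* y) +∣x∣≡-x) (ring x y)) inv
  where
  ring : ∀ x y → - x * y ≡ x * - y
  ring = solve-∀

+p∣+p^s : ∀ {p s} → 1 ≤ s → + p ∣ + (p ^ s)
+p∣+p^s {p} {suc s} _ = ∣.divides (+ (p ^ s)) (trans (ℤ.pos-* p (p ^ s)) (ℤ.*-comm (+ p) (+ (p ^ s))))

module _ {p : ℕ} (p-prime : Prime p) where

  p∤1 : ¬ + p ∣ + 1
  p∤1 p∣1 = ℕ.nonTrivial⇒≢1 {{prime⇒nonTrivial p-prime}} (ℕ.∣1⇒≡1 (∣.∣⇒∣ᵤ p∣1))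

  p^s∤1 : ∀ {s} → 1 ≤ s → ¬ + (p ^ s) ∣ + 1
  p^s∤1 s≥1 = p∤1 ∘ ∣.∣-trans (+p∣+p^s s≥1)

  coprime-pow : ∀ {n} → ¬ p ℕ.∣ n → ∀ s → Coprime (p ^ s) n
  coprime-pow p∤n zero    (d∣1 , _) = ℕ.∣1⇒≡1 d∣1
  coprime-pow {n} p∤n (suc s) {d} (d∣p^s+1 , d∣n) with p ℕ.∣? d
  ... | yes p∣d = contradiction (ℕ.∣-trans p∣d d∣n) p∤n
  ... | no  p∤d = coprime-pow p∤n s (coprime-divisor d-coprime-p d∣p^s+1 , d∣n)
    where
    d-coprime-p : Coprime d p
    d-coprime-p {c} (c∣d , c∣p) with prime⇒irreducible p-prime c∣p
    ... | inj₁ c≡1    = c≡1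
    ... | inj₂ refl   = contradiction c∣d p∤d

  cancel-unit : ∀ s {x y : ℤ} → ¬ + p ∣ x → + (p ^ s) ∣ y * x → + (p ^ s) ∣ y
  cancel-unit s {x} {y} p∤x p^s∣yx = ∣.∣ᵤ⇒∣ (coprime-divisor (coprime-pow (p∤x ∘ ∣.∣ᵤ⇒∣) s)
    (subst (p ^ s ℕ.∣_) (trans (ℤ.abs-* y x) (ℕ.*-comm ℤ.∣ y ∣ ℤ.∣ x ∣)) (∣.∣⇒∣ᵤ p^s∣yx)))

  inverse-mod : ∀ s {x : ℤ} → ¬ + p ∣ x → ∃ λ y → x * y ≡ + 1 [mod + (p ^ s) ]
  inverse-mod s {x} p∤x = ∣x∣-inverse⇒inverse {x = x} (bézout⇒inverse-mod (coprime-Bézout (coprime-pow (p∤x ∘ ∣.∣ᵤ⇒∣) s)))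

-- Maximal minors modulo p

FullRankMod : ∀ {k n} → ℤ → Mat k n → Set
FullRankMod {k} {n} d M = Σ (Fin k → Fin n) λ g → ¬ d ∣ det (λ i j → M i (g j))

unimodular⇒fullRankMod : ∀ {d q} {M : Mat k n} → d ∣ + q → ¬ d ∣ + 1 → Unimodular q M → FullRankMod d M
unimodular⇒fullRankMod {k} {d = d} {M = M} d∣q d∤1 (N , M⊗N≈1) =
  let h , d∤term = ∃¬∣-termMaps d _ d∤expansion in h , d∤term ∘ ∣.∣n⇒∣m*n (product (λ j → N (h j) j))
  where
  det≡1 : det (M ⊗ N) ≡ + 1 [mod d ]
  det≡1 = ≡-mod-weaken d∣q (≡-mod-trans (det-cong-mod (MatEq⇒≡-mod M⊗N≈1)) (≡-mod-reflexive (det-idMat {k})))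
  d∤expansion : ¬ d ∣ sumMaps (λ h → product (λ j → N (h j) j) * det (λ i j → M i (h j)))
  d∤expansion d∣Σ = d∤1 (≡0-mod⇒∣ (≡-mod-trans (≡-mod-sym det≡1)
    (≡-mod-trans (≡-mod-reflexive (det-⊗-expand M N)) (∣⇒≡0-mod d∣Σ))))

no-gap⇒preimage : (g : Fin k → Fin n) → ¬ (∃ λ j → ∀ i → g i ≢ j) → ∀ j → ∃ λ i → g i ≡ j
no-gap⇒preimage g no-gap j with Fin.any? (λ i → g i Fin.≟ j)
... | yes found = found
... | no ¬found = contradiction (j , λ i gi≡j → ¬found (i , gi≡j)) no-gap

∃-∉-image : k < n → (g : Fin k → Fin n) → ∃ λ j → ∀ i → g i ≢ j
∃-∉-image k<n g with Fin.any? (λ j → Fin.all? (λ i → ¬? (g i Fin.≟ j)))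
... | yes gap = gap
... | no no-gap with j , j′ , j<j′ , same ← Fin.pigeonhole k<n (proj₁ ∘ no-gap⇒preimage g no-gap) =
  contradiction (trans (sym (proj₂ (no-gap⇒preimage g no-gap j))) (trans (cong g same) (proj₂ (no-gap⇒preimage g no-gap j′))))
                (Fin.<⇒≢ j<j′)

idMat-diagonal : (j : Fin n) → idMat j j ≡ + 1
idMat-diagonal zero    = refl
idMat-diagonal (suc j) = idMat-diagonal j

idMat-off-diagonal : (i j : Fin n) → i ≢ j → idMat i j ≡ + 0
idMat-off-diagonal zero    zero    i≢j = contradiction refl i≢j
idMat-off-diagonal zero    (suc j) _   = refl
idMat-off-diagonal (suc i) zero    _   = refl
idMat-off-diagonal (suc i) (suc j) i≢j = idMat-off-diagonal i j (i≢j ∘ cong suc)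

fullRankMod-extend : ∀ {d} {X : Mat k n} → k < n → FullRankMod d X → ∃ λ w → FullRankMod d (w ∷ X)
fullRankMod-extend {k} {d = d} {X} k<n (g , d∤minor) =
  let j , j∉g = ∃-∉-image k<n g in idMat j , (j ∷ g) , d∤minor ∘ subst (d ∣_) (expand-first-row j j∉g)
  where
  expand-first-row : ∀ j → (∀ i → g i ≢ j) → det (λ a b → (idMat j ∷ X) a ((j ∷ g) b)) ≡ det (λ a b → X a (g b))
  expand-first-row j j∉g = begin
    + 1 * (idMat j j * det (λ a b → X a (g b))) + sumF (λ b → sign (suc b) * (idMat j (g b) * det (minor b)))
      ≡⟨ cong₂ _+_ (trans (ℤ.*-identityˡ _) (trans (cong (_* det (λ a b → X a (g b))) (idMat-diagonal j)) (ℤ.*-identityˡ _)))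
                   (sumF-zero {k} _ (λ b → trans (cong (λ x → sign (suc b) * (x * det (minor b))) (idMat-off-diagonal j (g b) (j∉g b ∘ sym)))
                                      (trans (cong (sign (suc b) *_) (ℤ.*-zeroˡ (det (minor b)))) (ℤ.*-zeroʳ (sign (suc b)))))) ⟩
    det (λ a b → X a (g b)) + + 0
      ≡⟨ ℤ.+-identityʳ _ ⟩
    det (λ a b → X a (g b)) ∎
    where
    open ≡-Reasoning
    minor : Fin k → Mat k k
    minor b a c = X a ((j ∷ g) (Fin.punchIn (suc b) c))

det-first-row-additive : (u v : Vect n) (X : Mat k n) (g : Fin (suc k) → Fin n) →
  det (λ i j → ((λ l → u l + v l) ∷ X) i (g j)) ≡ det (λ i j → (u ∷ X) i (g j)) + det (λ i j → (v ∷ X) i (g j))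
det-first-row-additive {n} {k} u v X g =
  trans (sumF-cong (λ j → ring (sign j) (u (g j)) (v (g j)) (det (minor j)))) (sumF-distrib-+ (term u) (term v))
  where
  minor : Fin (suc k) → Mat k k
  minor j a b = X a (g (Fin.punchIn j b))
  term : Vect n → Fin (suc k) → ℤ
  term x j = sign j * (x (g j) * det (minor j))
  ring : ∀ s a b D → s * ((a + b) * D) ≡ s * (a * D) + s * (b * D)
  ring = solve-∀

-- If u ∷ Y and v ∷ X both lose full rank modulo d, then (u + v) ∷ X and (u + v) ∷ Y keep it, by
-- additivity in the first row.
fullRankMod-common-extension : ∀ {d} {X Y : Mat k n} {u v : Vect n} → FullRankMod d (u ∷ X) → FullRankMod d (v ∷ Y) →
  ∃ λ w → FullRankMod d (w ∷ X) × FullRankMod d (w ∷ Y)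
fullRankMod-common-extension {d = d} {X} {Y} {u} {v} (g , d∤uX) (g′ , d∤vY)
  with d ∣? det (λ i j → (v ∷ X) i (g j)) | d ∣? det (λ i j → (u ∷ Y) i (g′ j))
... | no d∤vX | _         = v , (g , d∤vX) , (g′ , d∤vY)
... | yes _   | no d∤uY   = u , (g , d∤uX) , (g′ , d∤uY)
... | yes d∣vX | yes d∣uY = (λ l → u l + v l)
  , (g  , λ d∣ → d∤uX (∣.∣m+n∣n⇒∣m (subst (d ∣_) (det-first-row-additive u v X g) d∣) d∣vX))
  , (g′ , λ d∣ → d∤vY (∣.∣m+n∣m⇒∣n (subst (d ∣_) (det-first-row-additive u v Y g′) d∣) d∣uY))

fullRankMod-∷⇒∉rowSpace : ∀ {d} {X : Mat k n} {w : Vect n} → FullRankMod d (w ∷ X) → (a : Vect k) →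
  ¬ (∀ j → w j ≡ sumF (λ i → a i * X i j) [mod d ])
fullRankMod-∷⇒∉rowSpace {k} {d = d} {X} {w} (g , d∤minor) a w≈aX = d∤minor (≡0-mod⇒∣ (begin
  det (λ i j → (w ∷ X) i (g j)) ≈⟨ det-cong-mod (λ i j → rows i (g j)) ⟩
  det (K ⊗ (λ l j → X l (g j))) ≡⟨ det-⊗-vanishes (ℕ.n<1+n k) K (λ l j → X l (g j)) ⟩
  + 0                           ∎))
  where
  open ≡-mod-Reasoning d
  K : Mat (suc k) k
  K = a ∷ idMat
  rows : ∀ i j → (w ∷ X) i j ≡ (K ⊗ X) i j [mod d ]
  rows zero    j = w≈aX j
  rows (suc i) j = ≡-mod-reflexive (sym (sumF-idMatˡ i (λ l → X l j)))

-- When U ⊗ N ≈ 1, the vector (w ⊗ N) ⊗ U is the part of w lying in the row space of U.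
residual : ∀ {m n} → Vect n → Mat m n → Mat n m → Vect n
residual w U N l = w l - sumF (λ r → sumF (λ t → w t * N t r) * U r l)

unit-residual⇒unimodular-cons : ∀ {q m n} (w : Vect n) (U : Mat m n) (N : Mat n m) → MatEq q (U ⊗ N) idMat →
  (l : Fin n) (e : ℤ) → residual w U N l * e ≡ + 1 [mod + q ] → Unimodular q (w ∷ U)
unit-residual⇒unimodular-cons {q} {m} {n} w U N U⊗N≈1 l e residual·e≈1 = N′ , λ i j → ≡-mod⇒≈ (entry i j)
  where
  open ≡-mod-Reasoning (+ q)
  c : Vect m
  c r = sumF (λ t → w t * N t r)
  -- w · v ≡ 1 and U b · v ≡ 0; subtracting v c from N then makes the other columns orthogonal to w.
  v : Vect n
  v i = e * (idMat i l - sumF (λ r → N i r * U r l))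
  N′ : Mat n (suc m)
  N′ i zero    = v i
  N′ i (suc j) = N i j - v i * c j
  ·v : ∀ a → sumF (λ i → a i * v i) ≡ e * (a l - sumF (λ r → sumF (λ i → a i * N i r) * U r l))
  ·v a = P.begin
    sumF (λ i → a i * v i)
      P.≡⟨ sumF-cong (λ i → ring (a i) e (idMat i l) (sumF (λ r → N i r * U r l))) ⟩
    sumF (λ i → e * (a i * idMat i l) - e * (a i * sumF (λ r → N i r * U r l)))
      P.≡⟨ sumF-distrib-- (λ i → e * (a i * idMat i l)) (λ i → e * (a i * sumF (λ r → N i r * U r l))) ⟩
    sumF (λ i → e * (a i * idMat i l)) - sumF (λ i → e * (a i * sumF (λ r → N i r * U r l)))
      P.≡⟨ cong₂ _-_ (*-distribˡ-sumF e (λ i → a i * idMat i l)) (*-distribˡ-sumF e (λ i → a i * sumF (λ r → N i r * U r l))) ⟨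
    e * sumF (λ i → a i * idMat i l) - e * sumF (λ i → a i * sumF (λ r → N i r * U r l))
      P.≡⟨ cong₂ (λ x y → e * x - e * y) (sumF-idMatʳ l a) (sumF-assoc a N (λ r → U r l)) ⟩
    e * a l - e * sumF (λ r → sumF (λ i → a i * N i r) * U r l)
      P.≡⟨ ring₂ e (a l) (sumF (λ r → sumF (λ i → a i * N i r) * U r l)) ⟩
    e * (a l - sumF (λ r → sumF (λ i → a i * N i r) * U r l)) P.∎
    where
    module P = ≡-Reasoning
    ring : ∀ a e δ S → a * (e * (δ - S)) ≡ e * (a * δ) - e * (a * S)
    ring = solve-∀
    ring₂ : ∀ e x y → e * x - e * y ≡ e * (x - y)
    ring₂ = solve-∀
  ·N′ : ∀ a j → sumF (λ i → a i * N′ i (suc j)) ≡ sumF (λ i → a i * N i j) - sumF (λ i → a i * v i) * c j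
  ·N′ a j = P.begin
    sumF (λ i → a i * (N i j - v i * c j))               P.≡⟨ sumF-cong (λ i → ring (a i) (N i j) (v i) (c j)) ⟩
    sumF (λ i → a i * N i j - a i * v i * c j)           P.≡⟨ sumF-distrib-- (λ i → a i * N i j) (λ i → a i * v i * c j) ⟩
    sumF (λ i → a i * N i j) - sumF (λ i → a i * v i * c j)
      P.≡⟨ cong (_-_ (sumF (λ i → a i * N i j))) (*-distribʳ-sumF (c j) (λ i → a i * v i)) ⟨
    sumF (λ i → a i * N i j) - sumF (λ i → a i * v i) * c j P.∎
    where
    module P = ≡-Reasoning
    ring : ∀ a n v c → a * (n - v * c) ≡ a * n - a * v * c
    ring = solve-∀
  w·v≈1 : sumF (λ i → w i * v i) ≡ + 1 [mod + q ]
  w·v≈1 = begin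
    sumF (λ i → w i * v i) ≡⟨ ·v w ⟩
    e * residual w U N l   ≡⟨ ℤ.*-comm e (residual w U N l) ⟩
    residual w U N l * e   ≈⟨ residual·e≈1 ⟩
    + 1                    ∎
  U·v≈0 : ∀ b → sumF (λ i → U b i * v i) ≡ + 0 [mod + q ]
  U·v≈0 b = begin
    sumF (λ i → U b i * v i)                          ≡⟨ ·v (U b) ⟩
    e * (U b l - sumF (λ r → (U ⊗ N) b r * U r l))    ≈⟨ *-congˡ-mod e (+-congˡ-mod (U b l) (-‿cong-mod (sumF-cong-mod λ r →
                                                            *-congʳ-mod (U r l) (MatEq⇒≡-mod {M = U ⊗ N} {M′ = idMat} U⊗N≈1 b r)))) ⟩
    e * (U b l - sumF (λ r → idMat b r * U r l))      ≡⟨ cong (λ x → e * (U b l - x)) (sumF-idMatˡ b (λ r → U r l)) ⟩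
    e * (U b l - U b l)                               ≡⟨ cong (e *_) (ℤ.+-inverseʳ (U b l)) ⟩
    e * + 0                                           ≡⟨ ℤ.*-zeroʳ e ⟩
    + 0                                               ∎
  entry : ∀ i j → ((w ∷ U) ⊗ N′) i j ≡ idMat i j [mod + q ]
  entry zero    zero    = w·v≈1
  entry (suc b) zero    = U·v≈0 b
  entry zero    (suc j) = begin
    sumF (λ i → w i * N′ i (suc j))                 ≡⟨ ·N′ w j ⟩
    c j - sumF (λ i → w i * v i) * c j              ≈⟨ +-congˡ-mod (c j) (-‿cong-mod (*-congʳ-mod (c j) w·v≈1)) ⟩
    c j - + 1 * c j                                 ≡⟨ cong (_-_ (c j)) (ℤ.*-identityˡ (c j)) ⟩
    c j - c j                                       ≡⟨ ℤ.+-inverseʳ (c j) ⟩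
    + 0                                             ∎
  entry (suc b) (suc j) = begin
    sumF (λ i → U b i * N′ i (suc j))               ≡⟨ ·N′ (U b) j ⟩
    (U ⊗ N) b j - sumF (λ i → U b i * v i) * c j    ≈⟨ +-cong-mod (MatEq⇒≡-mod {M = U ⊗ N} {M′ = idMat} U⊗N≈1 b j)
                                                                  (-‿cong-mod (*-congʳ-mod (c j) (U·v≈0 b))) ⟩
    idMat b j - + 0 * c j                           ≡⟨⟩
    idMat b j - + 0                                 ≡⟨ ℤ.+-identityʳ (idMat b j) ⟩
    idMat b j                                       ∎

module _ {p s : ℕ} (p-prime : Prime p) (s≥1 : 1 ≤ s) where

  unimodular-cons : ∀ {m n} {X : Mat (suc m) n} {w : Vect n} {U : Mat m n} →
    FullRankMod (+ p) (w ∷ X) → Unimodular (p ^ s) U → (∀ b → RowSpace (p ^ s) X (U b)) → Unimodular (p ^ s) (w ∷ U)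
  unimodular-cons {m} {n} {X} {w} {U} wX-full (N , U⊗N≈1) U⊆X =
    let l , p∤residual = Fin.¬∀⟶∃¬ n _ (λ l → + p ∣? residual w U N l) w∉U
        e , residual·e≈1 = inverse-mod p-prime s p∤residual
    in unit-residual⇒unimodular-cons w U N U⊗N≈1 l e residual·e≈1
    where
    c : Vect m
    c r = sumF (λ t → w t * N t r)
    coeff : Fin m → Vect (suc m)
    coeff r = proj₁ (U⊆X r)
    combination : Vect (suc m)
    combination i = sumF (λ r → c r * coeff r i)
    w∉U : ¬ (∀ l → + p ∣ residual w U N l)
    w∉U p∣residual = fullRankMod-∷⇒∉rowSpace {X = X} {w} wX-full combination λ j → begin
      w j                                           ≈⟨ mod (p∣residual j) ⟩
      sumF (λ r → c r * U r j)                      ≈⟨ sumF-cong-mod (λ r → *-congˡ-mod (c r)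
                                                         (≡-mod-weaken (+p∣+p^s s≥1) (≈⇒≡-mod (proj₂ (U⊆X r) j)))) ⟩
      sumF (λ r → c r * sumF (λ i → coeff r i * X i j)) ≡⟨ sumF-assoc c coeff (λ i → X i j) ⟩
      sumF (λ i → combination i * X i j)            ∎
      where open ≡-mod-Reasoning (+ p)

-- Inner rank and McCoy rank

factors⇒minors-vanish : ∀ {q a b r} {S : Mat a b} → Factors q S r → r < k →
  (f : Fin k → Fin a) (g : Fin k → Fin b) → det (λ i j → S (f i) (g j)) ≡ + 0 [mod + q ]
factors⇒minors-vanish {q = q} {S = S} (C , D , S≈CD) r<k f g = begin
  det (λ i j → S (f i) (g j))                   ≈⟨ det-cong-mod (λ i j → ≈⇒≡-mod (S≈CD (f i) (g j))) ⟩
  det ((λ i → C (f i)) ⊗ (λ l j → D l (g j)))   ≡⟨ det-⊗-vanishes r<k (λ i → C (f i)) (λ l j → D l (g j)) ⟩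
  + 0                                           ∎
  where open ≡-mod-Reasoning (+ q)

row∈rowSpace : ∀ {q r n} (R : Mat r n) (i : Fin r) → RowSpace q R (R i)
row∈rowSpace R i = idMat i , λ j → ≡-mod⇒≈ (≡-mod-reflexive (sym (sumF-idMatˡ i (λ l → R l j))))

rowSpace-∷ : ∀ {q r n} {R : Mat r n} {v : Vect n} (w : Vect n) → RowSpace q R v → RowSpace q (w ∷ R) v
rowSpace-∷ {R = R} {v} w (c , v≈cR) = (+ 0 ∷ c) , λ j →
  ≡-mod⇒≈ (≡-mod-trans (≈⇒≡-mod {x = v j} (v≈cR j)) (≡-mod-reflexive (sym (ℤ.+-identityˡ (sumF (λ i → c i * R i j))))))

stack-factors : ∀ {q a b r n} {A : Mat a n} {B : Mat b n} {R : Mat r n} →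
  (∀ i → RowSpace q R (A i)) → (∀ i → RowSpace q R (B i)) → Factors q (stack A B) r
stack-factors {q} {a} {b} {r} {n} {A} {B} {R} A⊆R B⊆R = C , R , stack≈CR
  where
  C : Mat (a ℕ.+ b) r
  C i = [ proj₁ ∘ A⊆R , proj₁ ∘ B⊆R ]′ (Fin.splitAt a i)
  stack≈CR : MatEq q (stack A B) (C ⊗ R)
  stack≈CR i j with Fin.splitAt a i
  ... | inj₁ x = proj₂ (A⊆R x) j
  ... | inj₂ y = proj₂ (B⊆R y) j

stack-join : ∀ {a b n} (A : Mat a n) (B : Mat b n) (x : Fin a ⊎ Fin b) → stack A B (Fin.join a b x) ≡ [ A , B ]′ x
stack-join {a} {b} A B x = cong [ A , B ]′ (Fin.splitAt-join a b x)

join-injective : ∀ a b → Injective _≡_ _≡_ (Fin.join a b)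
join-injective a b {x} {y} eq = trans (sym (Fin.splitAt-join a b x)) (trans (cong (Fin.splitAt a) eq) (Fin.splitAt-join a b y))

module _ {p s : ℕ} (p-prime : Prime p) (s≥1 : 1 ≤ s) where

  innerRank∧mcCoyRank : ∀ {a b r} {S : Mat a b} → Factors (p ^ s) S r →
    (f : Fin r → Fin a) (g : Fin r → Fin b) → Injective _≡_ _≡_ f → ¬ + p ∣ det (λ i j → S (f i) (g j)) →
    InnerRank (p ^ s) S r × McCoyRank (p ^ s) S r
  innerRank∧mcCoyRank {r = r} {S} S-factors f g f-injective p∤minor =
    (S-factors , no-smaller-factorization) , (annihilator-trivial , no-larger-rank)
    where
    minor : ℤ
    minor = det (λ i j → S (f i) (g j))
    no-smaller-factorization : ∀ r′ → r′ < r → ¬ Factors (p ^ s) S r′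
    no-smaller-factorization r′ r′<r S-factors′ =
      p∤minor (∣.∣-trans (+p∣+p^s s≥1) (≡0-mod⇒∣ (factors⇒minors-vanish {S = S} S-factors′ r′<r f g)))
    annihilator-trivial : AnnMinorsZero (p ^ s) S r
    annihilator-trivial x x-annihilates = ≡-mod⇒≈ (∣⇒≡0-mod (cancel-unit p-prime s {y = x} p∤minor
      (≡0-mod⇒∣ (≈⇒≡-mod {x = x * minor} {y = + 0}
        (x-annihilates f g f-injective (minor-columns-injective (+ p) (S ∘ f) g p∤minor))))))
    no-larger-rank : ∀ k → r < k → ¬ AnnMinorsZero (p ^ s) S k
    no-larger-rank k r<k minors-faithful = p^s∤1 p-prime s≥1 (≡0-mod⇒∣ (≈⇒≡-mod {x = + 1} {y = + 0} (minors-faithful (+ 1)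
      (λ f′ g′ _ _ → ≡-mod⇒≈ (≡-mod-trans (≡-mod-reflexive (ℤ.*-identityˡ (det (λ i j → S (f′ i) (g′ j)))))
                                          (factors⇒minors-vanish {S = S} S-factors r<k f′ g′))))))

  mcAdj-of-shared-rows : ∀ {m n} {A B : Mat m n} {R : Mat (suc m) n} →
    (∀ i → RowSpace (p ^ s) R (A i)) → (∀ i → RowSpace (p ^ s) R (B i)) → FullRankMod (+ p) R →
    (h : Fin (suc m) → Fin m ⊎ Fin m) → Injective _≡_ _≡_ h → (∀ i → [ A , B ]′ (h i) ≡ R i) → McAdj (p ^ s) A B
  mcAdj-of-shared-rows {m} {A = A} {B} {R} A⊆R B⊆R (g , p∤minor) h h-injective h-rows =
    innerRank∧mcCoyRank {S = stack A B} (stack-factors {A = A} {B} {R} A⊆R B⊆R) (Fin.join m m ∘ h) g (h-injective ∘ join-injective m m)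
      (p∤minor ∘ subst (+ p ∣_) (det-cong (λ i j → cong (λ row → row (g j)) (trans (stack-join A B (h i)) (h-rows i)))))

  mcAdj-through-common-extension : ∀ {m n} {X Y : Mat (suc m) n} {U : Mat m n} {w : Vect n} →
    FullRankMod (+ p) (w ∷ X) → FullRankMod (+ p) (w ∷ Y) →
    (∀ b → RowSpace (p ^ s) X (U b) × RowSpace (p ^ s) Y (U b)) → McAdj (p ^ s) X (w ∷ U) × McAdj (p ^ s) (w ∷ U) Y
  mcAdj-through-common-extension {m} {n} {X} {Y} {U} {w} wX-full wY-full U⊆X∩Y =
    mcAdj-of-shared-rows (row∈rowSpace (w ∷ X) ∘ suc) (Z⊆ {X} proj₁) wX-full (inj₂ zero ∷ inj₁) Z-last-injective Z-last ,
    mcAdj-of-shared-rows (Z⊆ {Y} proj₂) (row∈rowSpace (w ∷ Y) ∘ suc) wY-full (inj₁ zero ∷ inj₂) Z-first-injective Z-first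
    where
    Z⊆ : ∀ {V} → (∀ {b} → RowSpace (p ^ s) X (U b) × RowSpace (p ^ s) Y (U b) → RowSpace (p ^ s) V (U b)) →
      ∀ i → RowSpace (p ^ s) (w ∷ V) ((w ∷ U) i)
    Z⊆ {V} select zero    = row∈rowSpace (w ∷ V) zero
    Z⊆ {V} select (suc b) = rowSpace-∷ {R = V} {U b} w (select (U⊆X∩Y b))
    Z-last-injective : Injective _≡_ _≡_ (inj₂ zero ∷ inj₁)
    Z-last-injective {zero}  {zero}  _    = refl
    Z-last-injective {suc i} {suc j} refl = refl
    Z-last : ∀ i → [ X , w ∷ U ]′ ((inj₂ zero ∷ inj₁) i) ≡ (w ∷ X) i
    Z-last zero    = refl
    Z-last (suc i) = refl
    Z-first-injective : Injective _≡_ _≡_ (inj₁ zero ∷ inj₂)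
    Z-first-injective {zero}  {zero}  _    = refl
    Z-first-injective {suc i} {suc j} refl = refl
    Z-first : ∀ i → [ w ∷ U , Y ]′ ((inj₁ zero ∷ inj₂) i) ≡ (w ∷ Y) i
    Z-first zero    = refl
    Z-first (suc i) = refl

  mc-bridge : ∀ {m n} → suc m < n → {X Y : Mat (suc m) n} → Unimodular (p ^ s) X → Unimodular (p ^ s) Y →
    Adj (p ^ s) X Y → ∃ λ Z → Unimodular (p ^ s) Z × McAdj (p ^ s) X Z × McAdj (p ^ s) Z Y
  mc-bridge m<n {X} {Y} X-unimodular Y-unimodular ((U , U-unimodular , U⊆X∩Y) , _) =
    let u , uX-full = fullRankMod-extend {X = X} m<n (fullRank {M = X} X-unimodular)
        v , vY-full = fullRankMod-extend {X = Y} m<n (fullRank {M = Y} Y-unimodular)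
        w , wX-full , wY-full = fullRankMod-common-extension {X = X} {Y} {u} {v} uX-full vY-full
    in w ∷ U , unimodular-cons p-prime s≥1 {X = X} wX-full U-unimodular (proj₁ ∘ U⊆X∩Y) ,
       mcAdj-through-common-extension {X = X} {Y} wX-full wY-full U⊆X∩Y
    where
    fullRank : ∀ {m n} {M : Mat m n} → Unimodular (p ^ s) M → FullRankMod (+ p) M
    fullRank {M = M} = unimodular⇒fullRankMod {M = M} (+p∣+p^s s≥1) (p∤1 p-prime)

-- Subdividing walks

double : ℕ → ℕ
double zero    = zero
double (suc k) = suc (suc (double k))

double≡2* : ∀ k → double k ≡ 2 ℕ.* k
double≡2* zero    = refl
double≡2* (suc k) = trans (cong (λ n → ℕ.suc (ℕ.suc n)) (double≡2* k)) (sym (ℕ.*-suc 2 k))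

Chain : {V : Set} → (V → Set) → (V → V → Set) → ℕ → V → V → Set
Chain {V} Good R k x y = Σ (Fin (suc k) → V) λ X →
  (∀ i → Good (X i)) × X zero ≡ x × X (Fin.fromℕ k) ≡ y × (∀ (i : Fin k) → R (X (Fin.inject₁ i)) (X (suc i)))

module _ {V : Set} {Good : V → Set} where

  chain-cons : ∀ {R : V → V → Set} {k x y z} → Good x → R x y → Chain Good R k y z → Chain Good R (suc k) x z
  chain-cons {x = x} good-x x~y (X , good , refl , end , steps) =
    x ∷ X , (λ { zero → good-x ; (suc i) → good i }) , refl , end , λ { zero → x~y ; (suc i) → steps i }

  subdivide : ∀ {R S : V → V → Set} → (∀ {x y} → Good x → Good y → R x y → ∃ λ z → Good z × S x z × S z y) →
    ∀ {k x y} → Chain Good R k x y → Chain Good S (double k) x y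
  subdivide bridge {zero}  (X , good , refl , refl , _) = (λ _ → X zero) , (λ _ → good zero) , refl , refl , λ ()
  subdivide {S = S} bridge {suc k} (X , good , refl , refl , steps) =
    let z , good-z , x~z , z~y = bridge (good zero) (good (suc zero)) (steps zero)
    in chain-cons {R = S} (good zero) x~z (chain-cons {R = S} good-z z~y
         (subdivide bridge (X ∘ suc , good ∘ suc , refl , refl , steps ∘ suc)))

lemma5p2 : (p s : ℕ) → Prime p → 1 ≤ s → (n m : ℕ) → m < n → 1 ≤ m →
    (A B : Mat m n) → Unimodular (p ^ s) A → Unimodular (p ^ s) B →
    ¬ SameVertex (p ^ s) A B →
    (k : ℕ) → Dist (p ^ s) A B k →
    McWalk (p ^ s) A B (2 ℕ.* k)
lemma5p2 p s p-prime s≥1 n (suc m) m<n _ A B _ _ _ k ((X , X-unimodular , X₀≈A , Xₖ≈B , X-adjacent) , _) =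
  subst (McWalk (p ^ s) A B) (double≡2* k)
    (endpoints-up-to-≈ (subdivide (mc-bridge p-prime s≥1 m<n) (X , X-unimodular , refl , refl , X-adjacent)))
  where
  endpoints-up-to-≈ : Chain (Unimodular (p ^ s)) (McAdj (p ^ s)) (double k) (X zero) (X (Fin.fromℕ k)) → McWalk (p ^ s) A B (double k)
  endpoints-up-to-≈ (Y , Y-unimodular , Y₀≡X₀ , Yₗ≡Xₖ , Y-adjacent) =
    Y , Y-unimodular , subst (λ T → MatEq (p ^ s) T A) (sym Y₀≡X₀) X₀≈A ,
    subst (λ T → MatEq (p ^ s) T B) (sym Yₗ≡Xₖ) Xₖ≈B , Y-adjacent
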